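{- Let $K$ be a field of characteristic not $2$ in which $-1$ is a square. If $(a_n,b_n)\in S_K^{\mathrm{back}_1}$, then either both parents of $(a_n,b_n)$ lie in $S_K^{\mathrm{back}_1}$ or neither does.
   Context: $S_K=\{(\alpha,\beta)\in K^2:\alpha,\beta,\alpha+\beta,\alpha-\beta\neq 0\}$. For $(\alpha,\beta),(\gamma,\delta)\in S_K$ write $(\alpha,\beta)\mapsto(\gamma,\delta)$, and call $(\alpha,\beta)$ a parent of $(\gamma,\delta)$, if $2\gamma=\alpha+\beta$ and $\delta^2=\alpha\beta$. $S_K^{\mathrm{back}_1}$ is the set of nodes in $S_K$ having at least one parent in $S_K$ (such a node has exactly two parents). -}

module Defs where

open import Level using (Level; _⊔_)
open import Algebra.Bundles using (CommutativeRing)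
open import Data.Product using (_×_; _,_; ∃; Σ)
open import Relation.Nullary using (¬_)

record IsField {c ℓ : Level} (K : CommutativeRing c ℓ) : Set (c ⊔ ℓ) where
  open CommutativeRing K
  field
    1≉0 : ¬ (1# ≈ 0#)
    inverse : ∀ x → ¬ (x ≈ 0#) → ∃ λ y → x * y ≈ 1#

module _ {c ℓ : Level} (K : CommutativeRing c ℓ) where
  open CommutativeRing K

  CharNot2 : Set ℓ
  CharNot2 = ¬ ((1# + 1#) ≈ 0#)

  MinusOneSquare : Set (c ⊔ ℓ)
  MinusOneSquare = ∃ λ i → i * i ≈ - 1#

  InS : Carrier × Carrier → Set ℓ
  InS (α , β) = ¬ (α ≈ 0#) × ¬ (β ≈ 0#) × ¬ ((α + β) ≈ 0#) × ¬ ((α - β) ≈ 0#)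

  Parent : Carrier × Carrier → Carrier × Carrier → Set ℓ
  Parent (α , β) (γ , δ) =
    InS (α , β) × InS (γ , δ) × ((1# + 1#) * γ ≈ α + β) × (δ * δ ≈ α * β)

  Back1 : Carrier × Carrier → Set (c ⊔ ℓ)
  Back1 q = InS q × ∃ λ p → Parent p q

{-# OPTIONS --safe #-}
-- A node (α, β) of S_K has a parent exactly when α² − β² is a square: the parent
-- (a, b) yields α² − β² = ((a − b)/2)², and a square root t yields the parent
-- (α + t, α − t). The two parents (α, β), (α′, β′) of a node share sum and product,
-- so (α′ − β′)² = (α − β)² and α′² − β′² = (α² − β²) r with r = (α′ − β′)/(α − β)
-- and r² = 1. When −1 is a square every such r is a square, hence α² − β² is a
-- square if and only if α′² − β′² is.
module Submission where

open import Defs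
open import Level using (Level; _⊔_)
open import Algebra.Bundles using (CommutativeRing)
open import Algebra.Solver.Ring.AlmostCommutativeRing
  using (_-Raw-AlmostCommutative⟶_; fromCommutativeRing)
open import Data.Integer as ℤ using (ℤ; +_; -[1+_]; _⊖_; sign; ∣_∣; _◃_)
import Data.Integer.Properties as ℤ
open import Data.Maybe as Maybe using (Maybe)
open import Data.Nat as ℕ using (zero; suc)
import Data.Nat.Properties as ℕ
open import Data.Product using (_×_; _,_; ∃; proj₁; proj₂)
open import Data.Sign as Sign using (Sign)
open import Function using (_∘_)
open import Function.Bundles using (_⇔_; mk⇔; Equivalence)
import Relation.Binary.PropositionalEquality as ≡
open import Relation.Nullary.Decidable using (dec⇒maybe)

-- The ring solver decides equality of coefficients, which a general commutative ring
-- cannot do, so coefficients are integers, read in R through the canonical map ℤ → R.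
module IntegerCoefficientSolver {c ℓ} (R : CommutativeRing c ℓ) where
  open CommutativeRing R
  open import Algebra.Properties.Ring ring using (-1*x≈-x; -0#≈0#)
  open import Algebra.Properties.AbelianGroup +-abelianGroup using (⁻¹-∙-comm)
  open import Algebra.Properties.Group +-group using (⁻¹-involutive)
  open import Algebra.Properties.CommutativeSemigroup *-commutativeSemigroup using (interchange)
  open import Algebra.Properties.Semiring.Mult.TCOptimised semiring using (1+×; ×-homo-+; ×1-homo-*) renaming (_×_ to _×′_)
  open import Relation.Binary.Reasoning.Setoid setoid

  fromℤ : ℤ → Carrier
  fromℤ (+ n)    = n ×′ 1#
  fromℤ -[1+ n ] = - (suc n ×′ 1#)

  fromSign : Sign → Carrier
  fromSign Sign.+ = 1#
  fromSign Sign.- = - 1#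

  1+x-[1+y]≈x-y : ∀ x y → (1# + x) - (1# + y) ≈ x - y
  1+x-[1+y]≈x-y x y = begin
    (1# + x) - (1# + y)      ≈⟨ +-cong (+-comm x 1#) (⁻¹-∙-comm 1# y) ⟨
    (x + 1#) + (- 1# + - y)  ≈⟨ +-assoc x 1# _ ⟩
    x + (1# + (- 1# + - y))  ≈⟨ +-congˡ (+-assoc 1# (- 1#) _) ⟨
    x + ((1# - 1#) + - y)    ≈⟨ +-congˡ (+-congʳ (-‿inverseʳ 1#)) ⟩
    x + (0# + - y)           ≈⟨ +-congˡ (+-identityˡ _) ⟩
    x - y                    ∎

  fromℤ-⊖ : ∀ m n → fromℤ (m ⊖ n) ≈ m ×′ 1# - n ×′ 1#
  fromℤ-⊖ m       zero    = sym (trans (+-congˡ -0#≈0#) (+-identityʳ _))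
  fromℤ-⊖ zero    (suc n) = sym (+-identityˡ _)
  fromℤ-⊖ (suc m) (suc n) = begin
    fromℤ (suc m ⊖ suc n)            ≡⟨ ≡.cong fromℤ (ℤ.[1+m]⊖[1+n]≡m⊖n m n) ⟩
    fromℤ (m ⊖ n)                    ≈⟨ fromℤ-⊖ m n ⟩
    m ×′ 1# - n ×′ 1#                ≈⟨ 1+x-[1+y]≈x-y _ _ ⟨
    (1# + m ×′ 1#) - (1# + n ×′ 1#)  ≈⟨ +-cong (1+× m 1#) (-‿cong (1+× n 1#)) ⟨
    suc m ×′ 1# - suc n ×′ 1#        ∎

  fromℤ-+ : ∀ i j → fromℤ (i ℤ.+ j) ≈ fromℤ i + fromℤ j
  fromℤ-+ (+ m)    (+ n)    = ×-homo-+ 1# m n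
  fromℤ-+ (+ m)    -[1+ n ] = fromℤ-⊖ m (suc n)
  fromℤ-+ -[1+ m ] (+ n)    = trans (fromℤ-⊖ n (suc m)) (+-comm _ _)
  fromℤ-+ -[1+ m ] -[1+ n ] = begin
    - (suc (suc (m ℕ.+ n)) ×′ 1#)      ≡⟨ ≡.cong (λ k → - (suc k ×′ 1#)) (ℕ.+-suc m n) ⟨
    - ((suc m ℕ.+ suc n) ×′ 1#)        ≈⟨ -‿cong (×-homo-+ 1# (suc m) (suc n)) ⟩
    - (suc m ×′ 1# + suc n ×′ 1#)      ≈⟨ ⁻¹-∙-comm _ _ ⟨
    - (suc m ×′ 1#) + - (suc n ×′ 1#)  ∎

  fromℤ-neg : ∀ i → fromℤ (ℤ.- i) ≈ - fromℤ i
  fromℤ-neg -[1+ n ]    = sym (⁻¹-involutive _)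
  fromℤ-neg (+ zero)    = sym -0#≈0#
  fromℤ-neg (+ (suc n)) = refl

  fromℤ-◃ : ∀ s n → fromℤ (s ◃ n) ≈ fromSign s * n ×′ 1#
  fromℤ-◃ s       zero    = sym (zeroʳ _)
  fromℤ-◃ Sign.+  (suc n) = sym (*-identityˡ _)
  fromℤ-◃ Sign.-  (suc n) = sym (-1*x≈-x _)

  fromSign-* : ∀ s t → fromSign (s Sign.* t) ≈ fromSign s * fromSign t
  fromSign-* Sign.+ t      = sym (*-identityˡ _)
  fromSign-* Sign.- Sign.+ = sym (*-identityʳ _)
  fromSign-* Sign.- Sign.- = sym (trans (-1*x≈-x _) (⁻¹-involutive 1#))

  fromℤ-* : ∀ i j → fromℤ (i ℤ.* j) ≈ fromℤ i * fromℤ j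
  fromℤ-* i j = begin
    fromℤ (sign i Sign.* sign j ◃ ∣ i ∣ ℕ.* ∣ j ∣)
      ≈⟨ fromℤ-◃ (sign i Sign.* sign j) (∣ i ∣ ℕ.* ∣ j ∣) ⟩
    fromSign (sign i Sign.* sign j) * (∣ i ∣ ℕ.* ∣ j ∣) ×′ 1#
      ≈⟨ *-cong (fromSign-* (sign i) (sign j)) (×1-homo-* ∣ i ∣ ∣ j ∣) ⟩
    (fromSign (sign i) * fromSign (sign j)) * (∣ i ∣ ×′ 1# * ∣ j ∣ ×′ 1#)
      ≈⟨ interchange _ _ _ _ ⟩
    (fromSign (sign i) * ∣ i ∣ ×′ 1#) * (fromSign (sign j) * ∣ j ∣ ×′ 1#)
      ≈⟨ *-cong (fromℤ-sign-abs i) (fromℤ-sign-abs j) ⟨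
    fromℤ i * fromℤ j
      ∎
    where
    fromℤ-sign-abs : ∀ k → fromℤ k ≈ fromSign (sign k) * ∣ k ∣ ×′ 1#
    fromℤ-sign-abs k = trans (reflexive (≡.cong fromℤ (≡.sym (ℤ.◃-inverse k)))) (fromℤ-◃ (sign k) ∣ k ∣)

  fromℤ-morphism : ℤ.+-*-rawRing -Raw-AlmostCommutative⟶ fromCommutativeRing R
  fromℤ-morphism = record
    { ⟦_⟧    = fromℤ
    ; +-homo = fromℤ-+
    ; *-homo = fromℤ-*
    ; -‿homo = fromℤ-neg
    ; 0-homo = refl
    ; 1-homo = refl
    }

  fromℤ-≟ : ∀ i j → Maybe (fromℤ i ≈ fromℤ j)
  fromℤ-≟ i j = Maybe.map (reflexive ∘ ≡.cong fromℤ) (dec⇒maybe (i ℤ.≟ j))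

  open import Algebra.Solver.Ring ℤ.+-*-rawRing (fromCommutativeRing R) fromℤ-morphism fromℤ-≟ public

module CommutativeRingProperties {c ℓ} (K : CommutativeRing c ℓ) where
  open CommutativeRing K
  open import Algebra.Properties.Group +-group using (x≈y⇒x∙y⁻¹≈ε)
  open import Algebra.Properties.CommutativeSemigroup *-commutativeSemigroup using (interchange)
  open IntegerCoefficientSolver K
  open import Relation.Binary.Reasoning.Setoid setoid

  IsSquare : Carrier → Set (c ⊔ ℓ)
  IsSquare x = ∃ λ s → s * s ≈ x

  IsSquare-resp-≈ : ∀ {x y} → x ≈ y → IsSquare x → IsSquare y
  IsSquare-resp-≈ x≈y (s , ss≈x) = s , trans ss≈x x≈y

  IsSquare-* : ∀ {x y} → IsSquare x → IsSquare y → IsSquare (x * y)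
  IsSquare-* (s , ss≈x) (t , tt≈y) = s * t , trans (interchange s t s t) (*-cong ss≈x tt≈y)

  x*y≉0⇒x≉0 : ∀ {x y} → x * y ≉ 0# → x ≉ 0#
  x*y≉0⇒x≉0 {x} {y} xy≉0 x≈0 = xy≉0 (trans (*-congʳ x≈0) (zeroˡ y))

  x*y≉0⇒y≉0 : ∀ {x y} → x * y ≉ 0# → y ≉ 0#
  x*y≉0⇒y≉0 {x} {y} xy≉0 y≈0 = xy≉0 (trans (*-congˡ y≈0) (zeroʳ x))

  cancel-multiple : ∀ {x y e f} k → e ≈ f → x ≈ y + k * (e - f) → x ≈ y
  cancel-multiple {x} {y} {e} {f} k e≈f x≈y+k[e-f] = begin
    x                ≈⟨ x≈y+k[e-f] ⟩
    y + k * (e - f)  ≈⟨ +-congˡ (*-congˡ (x≈y⇒x∙y⁻¹≈ε e≈f)) ⟩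
    y + k * 0#       ≈⟨ +-congˡ (zeroʳ k) ⟩
    y + 0#           ≈⟨ +-identityʳ y ⟩
    y                ∎

  [x-y]²≈[x+y]²-4xy : ∀ x y → (x - y) * (x - y) ≈ (x + y) * (x + y) - (1# + 1#) * (1# + 1#) * (x * y)
  [x-y]²≈[x+y]²-4xy = solve 2 (λ x y →
    (x :- y) :* (x :- y) := (x :+ y) :* (x :+ y) :- con (+ 2) :* con (+ 2) :* (x :* y)) refl

  same-sum-product⇒same-difference-square : ∀ {x y x′ y′} → x + y ≈ x′ + y′ → x * y ≈ x′ * y′ →
    (x - y) * (x - y) ≈ (x′ - y′) * (x′ - y′)
  same-sum-product⇒same-difference-square {x} {y} {x′} {y′} sum≈ product≈ = begin
    (x - y) * (x - y)                                        ≈⟨ [x-y]²≈[x+y]²-4xy x y ⟩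
    (x + y) * (x + y) - (1# + 1#) * (1# + 1#) * (x * y)      ≈⟨ +-cong (*-cong sum≈ sum≈) (-‿cong (*-congˡ product≈)) ⟩
    (x′ + y′) * (x′ + y′) - (1# + 1#) * (1# + 1#) * (x′ * y′) ≈⟨ [x-y]²≈[x+y]²-4xy x′ y′ ⟨
    (x′ - y′) * (x′ - y′)                                    ∎

  -- The witness is 1 when r = 1 and i when r = −1; equality in K being undecidable,
  -- a single formula has to cover both cases.
  x*x≈1⇒IsSquare : ∀ ½ → (1# + 1#) * ½ ≈ 1# → IsSquare (- 1#) → ∀ {r} → r * r ≈ 1# → IsSquare r
  x*x≈1⇒IsSquare ½ 2½≈1 (i , ii≈-1) {r} rr≈1 = ½ * ((1# + r) + i * (1# - r)) ,
    cancel-multiple _ 2½≈1 (cancel-multiple _ rr≈1 (cancel-multiple _ ii≈-1 (solve 3 (λ ½ i r →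
      (½ :* ((one :+ r) :+ i :* (one :- r))) :* (½ :* ((one :+ r) :+ i :* (one :- r)))
        := r
        :+ r :* (two :* ½ :+ one) :* (two :* ½ :- one)
        :+ (:- two :* i :* ½ :* ½) :* (r :* r :- one)
        :+ (½ :* ½ :* (one :- r) :* (one :- r)) :* (i :* i :- :- one)) refl ½ i r)))
    where
    one two : Polynomial 3
    one = con (+ 1)
    two = con (+ 2)

module FieldProperties {c ℓ} {K : CommutativeRing c ℓ} (F : IsField K) where
  open CommutativeRing K
  open IsField F
  open CommutativeRingProperties K
  open IntegerCoefficientSolver K using (solve; _:=_; _:+_; _:-_; _:*_; con)
  open import Algebra.Properties.CommutativeSemigroup *-commutativeSemigroup using (interchange)
  open import Relation.Binary.Properties.Setoid setoid using (≉-respˡ)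
  open import Relation.Binary.Reasoning.Setoid setoid

  x*y≉0 : ∀ {x y} → x ≉ 0# → y ≉ 0# → x * y ≉ 0#
  x*y≉0 {x} {y} x≉0 y≉0 xy≈0 with inverse y y≉0
  ... | y⁻¹ , yy⁻¹≈1 = x≉0 (begin
    x              ≈⟨ *-identityʳ x ⟨
    x * 1#         ≈⟨ *-congˡ yy⁻¹≈1 ⟨
    x * (y * y⁻¹)  ≈⟨ *-assoc x y y⁻¹ ⟨
    x * y * y⁻¹    ≈⟨ *-congʳ xy≈0 ⟩
    0# * y⁻¹       ≈⟨ zeroˡ y⁻¹ ⟩
    0#             ∎)

  same-sum-product⇒square-difference-ratio : ∀ {x y x′ y′} → x + y ≈ x′ + y′ → x * y ≈ x′ * y′ → x - y ≉ 0# →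
    ∃ λ r → r * r ≈ 1# × x′ * x′ - y′ * y′ ≈ (x * x - y * y) * r
  same-sum-product⇒square-difference-ratio {x} {y} {x′} {y′} sum≈ product≈ x-y≉0
    with inverse (x - y) x-y≉0
  ... | d , [x-y]d≈1 = (x′ - y′) * d , r*r≈1 , ratio
    where
    r*r≈1 : (x′ - y′) * d * ((x′ - y′) * d) ≈ 1#
    r*r≈1 = begin
      (x′ - y′) * d * ((x′ - y′) * d)    ≈⟨ interchange (x′ - y′) d (x′ - y′) d ⟩
      (x′ - y′) * (x′ - y′) * (d * d)    ≈⟨ *-congʳ (same-sum-product⇒same-difference-square sum≈ product≈) ⟨
      (x - y) * (x - y) * (d * d)        ≈⟨ interchange (x - y) (x - y) d d ⟩
      (x - y) * d * ((x - y) * d)        ≈⟨ *-cong [x-y]d≈1 [x-y]d≈1 ⟩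
      1# * 1#                            ≈⟨ *-identityˡ 1# ⟩
      1#                                 ∎
    ratio : x′ * x′ - y′ * y′ ≈ (x * x - y * y) * ((x′ - y′) * d)
    ratio = begin
      x′ * x′ - y′ * y′                  ≈⟨ solve 2 (λ x′ y′ → x′ :* x′ :- y′ :* y′ := (x′ :+ y′) :* (x′ :- y′)) refl x′ y′ ⟩
      (x′ + y′) * (x′ - y′)              ≈⟨ *-congʳ sum≈ ⟨
      (x + y) * (x′ - y′)                ≈⟨ *-identityʳ _ ⟨
      (x + y) * (x′ - y′) * 1#           ≈⟨ *-congˡ [x-y]d≈1 ⟨
      (x + y) * (x′ - y′) * ((x - y) * d) ≈⟨ solve 5 (λ x y x′ y′ d →
          (x :+ y) :* (x′ :- y′) :* ((x :- y) :* d) := (x :* x :- y :* y) :* ((x′ :- y′) :* d)) refl x y x′ y′ d ⟩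
      (x * x - y * y) * ((x′ - y′) * d)  ∎

  module _ (2≉0 : CharNot2 K) where

    ½ : Carrier
    ½ = proj₁ (inverse (1# + 1#) 2≉0)

    2*½≈1 : (1# + 1#) * ½ ≈ 1#
    2*½≈1 = proj₂ (inverse (1# + 1#) 2≉0)

    2x≈y⇒x≈½y : ∀ {x y} → (1# + 1#) * x ≈ y → x ≈ ½ * y
    2x≈y⇒x≈½y {x} {y} 2x≈y = begin
      x                     ≈⟨ *-identityˡ x ⟨
      1# * x                ≈⟨ *-congʳ 2*½≈1 ⟨
      (1# + 1#) * ½ * x     ≈⟨ solve 2 (λ ½ x → con (+ 2) :* ½ :* x := ½ :* (con (+ 2) :* x)) refl ½ x ⟩
      ½ * ((1# + 1#) * x)   ≈⟨ *-congˡ 2x≈y ⟩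
      ½ * y                 ∎

    parent⇒square-difference-IsSquare : ∀ {a b α β} → Parent K (a , b) (α , β) → IsSquare (α * α - β * β)
    parent⇒square-difference-IsSquare {a} {b} {α} {β} (_ , _ , 2α≈a+b , ββ≈ab) = ½ * (a - b) , (begin
      ½ * (a - b) * (½ * (a - b))
        ≈⟨ solve 3 (λ ½ a b → ½ :* (a :- b) :* (½ :* (a :- b))
             := ½ :* (a :+ b) :* (½ :* (a :+ b)) :- con (+ 2) :* ½ :* (con (+ 2) :* ½) :* (a :* b)) refl ½ a b ⟩
      ½ * (a + b) * (½ * (a + b)) - (1# + 1#) * ½ * ((1# + 1#) * ½) * (a * b)
        ≈⟨ +-cong (*-cong ½[a+b]≈α ½[a+b]≈α) (-‿cong (*-cong (*-cong 2*½≈1 2*½≈1) (sym ββ≈ab))) ⟩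
      α * α - 1# * 1# * (β * β)
        ≈⟨ +-congˡ (-‿cong (trans (*-congʳ (*-identityˡ 1#)) (*-identityˡ _))) ⟩
      α * α - β * β
        ∎)
      where
      ½[a+b]≈α : ½ * (a + b) ≈ α
      ½[a+b]≈α = sym (2x≈y⇒x≈½y 2α≈a+b)

    square-difference-IsSquare⇒parent : ∀ {α β} → InS K (α , β) → IsSquare (α * α - β * β) →
      ∃ λ p → Parent K p (α , β)
    square-difference-IsSquare⇒parent {α} {β} αβ∈S@(α≉0 , β≉0 , α+β≉0 , α-β≉0) (t , tt≈αα-ββ) =
      (α + t , α - t) , (α+t≉0 , α-t≉0 , sum≉0 , difference≉0) , αβ∈S , 2α≈sum , ββ≈product
      where
      2α≈sum : (1# + 1#) * α ≈ (α + t) + (α - t)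
      2α≈sum = solve 2 (λ α t → con (+ 2) :* α := (α :+ t) :+ (α :- t)) refl α t
      ββ≈product : β * β ≈ (α + t) * (α - t)
      ββ≈product = sym (begin
        (α + t) * (α - t)      ≈⟨ solve 2 (λ α t → (α :+ t) :* (α :- t) := α :* α :- t :* t) refl α t ⟩
        α * α - t * t          ≈⟨ +-congˡ (-‿cong tt≈αα-ββ) ⟩
        α * α - (α * α - β * β) ≈⟨ solve 2 (λ α β → α :* α :- (α :* α :- β :* β) := β :* β) refl α β ⟩
        β * β                  ∎)
      product≉0 : (α + t) * (α - t) ≉ 0#
      product≉0 = ≉-respˡ ββ≈product (x*y≉0 β≉0 β≉0)
      α+t≉0 : α + t ≉ 0#
      α+t≉0 = x*y≉0⇒x≉0 product≉0
      α-t≉0 : α - t ≉ 0#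
      α-t≉0 = x*y≉0⇒y≉0 product≉0
      sum≉0 : (α + t) + (α - t) ≉ 0#
      sum≉0 = ≉-respˡ 2α≈sum (x*y≉0 2≉0 α≉0)
      t≉0 : t ≉ 0#
      t≉0 = x*y≉0⇒x≉0 (≉-respˡ [α+β][α-β]≈tt (x*y≉0 α+β≉0 α-β≉0))
        where
        [α+β][α-β]≈tt : (α + β) * (α - β) ≈ t * t
        [α+β][α-β]≈tt = trans (solve 2 (λ α β → (α :+ β) :* (α :- β) := α :* α :- β :* β) refl α β) (sym tt≈αα-ββ)
      difference≉0 : (α + t) - (α - t) ≉ 0#
      difference≉0 = ≉-respˡ (solve 2 (λ α t → con (+ 2) :* t := (α :+ t) :- (α :- t)) refl α t) (x*y≉0 2≉0 t≉0)

    Back1⇔square-difference-IsSquare : ∀ {α β} → InS K (α , β) → Back1 K (α , β) ⇔ IsSquare (α * α - β * β)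
    Back1⇔square-difference-IsSquare αβ∈S = mk⇔
      (λ { (_ , _ , parent) → parent⇒square-difference-IsSquare parent })
      (λ square → αβ∈S , square-difference-IsSquare⇒parent αβ∈S square)

    Back1-resp-sum-product : MinusOneSquare K → ∀ {α β α′ β′} → InS K (α , β) → InS K (α′ , β′) →
      α + β ≈ α′ + β′ → α * β ≈ α′ * β′ → Back1 K (α , β) → Back1 K (α′ , β′)
    Back1-resp-sum-product -1-square αβ∈S@(_ , _ , _ , α-β≉0) α′β′∈S sum≈ product≈ αβ-back1
      with same-sum-product⇒square-difference-ratio sum≈ product≈ α-β≉0
    ... | r , rr≈1 , ratio = Equivalence.from (Back1⇔square-difference-IsSquare α′β′∈S)
      (IsSquare-resp-≈ (sym ratio)
        (IsSquare-* (Equivalence.to (Back1⇔square-difference-IsSquare αβ∈S) αβ-back1)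
                    (x*x≈1⇒IsSquare ½ 2*½≈1 -1-square rr≈1)))

corollary4p2 : {c ℓ : Level} (K : CommutativeRing c ℓ) → IsField K →
    CharNot2 K → MinusOneSquare K →
    (γ δ : CommutativeRing.Carrier K) → Back1 K (γ , δ) →
    (α β α′ β′ : CommutativeRing.Carrier K) →
    Parent K (α , β) (γ , δ) → Parent K (α′ , β′) (γ , δ) →
    Back1 K (α , β) ⇔ Back1 K (α′ , β′)
corollary4p2 K F 2≉0 -1-square γ δ _ α β α′ β′ (αβ∈S , _ , 2γ≈α+β , δδ≈αβ) (α′β′∈S , _ , 2γ≈α′+β′ , δδ≈α′β′) =
  mk⇔ (Back1-resp-sum-product 2≉0 -1-square αβ∈S α′β′∈S sum≈ product≈)
      (Back1-resp-sum-product 2≉0 -1-square α′β′∈S αβ∈S (sym sum≈) (sym product≈))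
  where
  open CommutativeRing K using (_≈_; _+_; _*_; sym; trans)
  open FieldProperties F using (Back1-resp-sum-product)

  sum≈ : α + β ≈ α′ + β′
  sum≈ = trans (sym 2γ≈α+β) 2γ≈α′+β′

  product≈ : α * β ≈ α′ * β′
  product≈ = trans (sym δδ≈αβ) δδ≈α′β′
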